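{- For every tabloid $\theta$, $w(\theta)=\mathrm{val}(\theta)$.
   Context: Young diagrams are in English notation. A tabloid of shape $\lambda$ and content $\mu$ (partitions of $n$) is a filling of the Young diagram of $\lambda$ with exactly $\mu_i$ entries equal to $i$ for each $i$, rows weakly increasing from left to right (no column condition). $w(\theta)$ is the number of pairs of cells with entries $i>k$ such that (1) the cell of $i$ is either below the cell of $k$ in the same column or in a column strictly to the left of $k$'s column, and (2) if there is a box immediately to the right of $k$'s cell, filled with $j$, then $i\le j$. The value of an entry $x$ (in a given cell) of $\theta$ is the number of cells containing entries smaller than $x$ that are either in the same column as $x$ and above it, or in the column immediately to the right of $x$'s column and below $x$'s row. $\mathrm{val}(\theta)$ is the sum of the values of all entries of $\theta$. -}

module Defs where

open import Data.Nat using (ℕ; zero; suc; _≤_; _≥_; _<_; _≤ᵇ_; _<ᵇ_; _≡ᵇ_)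
open import Data.Bool using (Bool; true; false; _∧_; _∨_; if_then_else_)
open import Data.List using (List; []; _∷_; _++_; map; length; zipWith; upTo; filterᵇ)
open import Data.List.Relation.Unary.All using (All)
open import Data.List.Relation.Unary.Linked using (Linked)
open import Data.Maybe using (Maybe; just; nothing; maybe; fromMaybe)
open import Data.Product using (_×_; _,_)
open import Data.Nat.ListAction using (sum)
open import Relation.Binary.PropositionalEquality using (_≡_)

-- A filling of a Young diagram: list of rows (top to bottom, English
-- notation), each row a list of entries (left to right).
Filling : Set
Filling = List (List ℕ)

nth : {A : Set} → List A → ℕ → Maybe A
nth []       _       = nothing
nth (x ∷ xs) zero    = just x
nth (x ∷ xs) (suc n) = nth xs n

entry : Filling → ℕ → ℕ → Maybe ℕ
entry θ r c with nth θ r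
... | nothing  = nothing
... | just row = nth row c

-- a cell together with its content: (row , column , entry)
Cell : Set
Cell = ℕ × ℕ × ℕ

cellsFrom : ℕ → Filling → List Cell
cellsFrom r []           = []
cellsFrom r (row ∷ rows) =
  zipWith (λ c v → (r , c , v)) (upTo (length row)) row ++ cellsFrom (suc r) rows

cells : Filling → List Cell
cells = cellsFrom 0

countPairs : (Cell → Cell → Bool) → List Cell → ℕ
countPairs P cs = sum (map (λ a → sum (map (λ b → if P a b then 1 else 0) cs)) cs)

wPair : Filling → Cell → Cell → Bool
wPair θ (ra , ca , i) (rb , cb , k) =
  (k <ᵇ i)
  ∧ (((ca ≡ᵇ cb) ∧ (rb <ᵇ ra)) ∨ (ca <ᵇ cb))
  ∧ maybe (λ j → i ≤ᵇ j) true (entry θ rb (suc cb))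

w : Filling → ℕ
w θ = countPairs (wPair θ) (cells θ)

valPair : Cell → Cell → Bool
valPair (rx , cx , x) (ry , cy , y) =
  (y <ᵇ x)
  ∧ (((cy ≡ᵇ cx) ∧ (ry <ᵇ rx)) ∨ ((cy ≡ᵇ suc cx) ∧ (rx <ᵇ ry)))

val : Filling → ℕ
val θ = countPairs valPair (cells θ)

IsPartition : List ℕ → Set
IsPartition p = All (λ x → 0 < x) p × Linked _≥_ p

-- μ_i (1-based), 0 when out of range
part : List ℕ → ℕ → ℕ
part μ zero    = 0
part μ (suc i) = fromMaybe 0 (nth μ i)

countEntry : ℕ → Filling → ℕ
countEntry i θ = sum (map (λ row → length (filterᵇ (i ≡ᵇ_) row)) θ)

record IsTabloid (sh μ : List ℕ) (θ : Filling) : Set where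
  field
    shape      : map length θ ≡ sh
    rowsWeakly : All (Linked _≤_) θ
    content    : ∀ i → countEntry i θ ≡ part μ i

{-# OPTIONS --safe #-}
module Submission where

-- Fix a cell holding i and count its partners in w and in val row by row.  In
-- a weakly increasing row the entries smaller than i form a prefix.  In a row
-- other than that of i, w can only pair i with the last cell of the prefix,
-- and does so when that cell lies weakly right of i's column (row above) or
-- strictly right of it (row below); val pairs i with the prefix cell in i's
-- column (row above) or in the next column (row below).  Either way both
-- counts are 1 exactly when the prefix reaches the same column.  In the row of
-- i itself val pairs nothing, and the prefix ends left of i, where w does not
-- look.

open import Defs
open import Data.Bool using (Bool; true; false; not; _∧_; _∨_; if_then_else_)
open import Data.Bool.Properties using (∧-zeroʳ; ∧-identityʳ)
open import Data.List using (List; []; _∷_; _++_; map; length; zipWith; drop; applyUpTo)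
open import Data.List.Properties using (map-++; map-cong-local)
open import Data.List.Relation.Unary.All as All using (All; []; _∷_)
open import Data.List.Relation.Unary.All.Properties using (++⁺)
open import Data.List.Relation.Unary.Linked as Linked using (Linked; _∷_)
open import Data.List.Relation.Unary.Linked.Properties using (Linked⇒All)
open import Data.Maybe using (Maybe; just; maybe)
open import Data.Nat using (ℕ; zero; suc; _+_; _<_; _≤_; z<s; _<ᵇ_; _≤ᵇ_; _≡ᵇ_)
open import Data.Nat.ListAction using (sum)
open import Data.Nat.ListAction.Properties using (sum-++)
open import Data.Nat.Properties
  using (_<?_; _≤?_; _≟_; <-cmp; ≤-refl; ≤-trans; <⇒≤; <⇒≱; ≤⇒≯; ≮⇒≥;
         +-assoc; +-suc; +-identityʳ; m<m+n)
open import Data.Product using (_,_)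
open import Function using (_∘_)
open import Relation.Binary using (tri<; tri≈; tri>)
open import Relation.Binary.PropositionalEquality
open import Relation.Nullary using (yes; no; contradiction)
open import Relation.Nullary.Decidable using (dec-true; dec-false)

𝟙 : Bool → ℕ
𝟙 b = if b then 1 else 0

-- These typecheck because does (m <? n) and does (m ≤? n) reduce to m <ᵇ n and m ≤ᵇ n.
<⇒<ᵇ≡true : ∀ {m n} → m < n → (m <ᵇ n) ≡ true
<⇒<ᵇ≡true {m} {n} = dec-true (m <? n)

≥⇒<ᵇ≡false : ∀ {m n} → n ≤ m → (m <ᵇ n) ≡ false
≥⇒<ᵇ≡false {m} {n} n≤m = dec-false (m <? n) (≤⇒≯ n≤m)

≤⇒≤ᵇ≡true : ∀ {m n} → m ≤ n → (m ≤ᵇ n) ≡ true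
≤⇒≤ᵇ≡true {m} {n} = dec-true (m ≤? n)

>⇒≤ᵇ≡false : ∀ {m n} → n < m → (m ≤ᵇ n) ≡ false
>⇒≤ᵇ≡false {m} {n} n<m = dec-false (m ≤? n) (<⇒≱ n<m)

n<ᵇn≡false : ∀ n → (n <ᵇ n) ≡ false
n<ᵇn≡false n = ≥⇒<ᵇ≡false (≤-refl {n})

≢⇒<ᵇ-flip : ∀ {m n} → m ≢ n → (n <ᵇ m) ≡ not (m <ᵇ n)
≢⇒<ᵇ-flip {m} {n} m≢n with <-cmp m n
... | tri< m<n _ _ rewrite <⇒<ᵇ≡true m<n = ≥⇒<ᵇ≡false (<⇒≤ m<n)
... | tri≈ _ m≡n _ = contradiction m≡n m≢n
... | tri> _ _ n<m rewrite ≥⇒<ᵇ≡false (<⇒≤ n<m) = <⇒<ᵇ≡true n<m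

module _ {A : Set} where

  nth-drop : ∀ n (xs : List A) → nth (drop n xs) 0 ≡ nth xs n
  nth-drop zero    xs       = refl
  nth-drop (suc n) []       = refl
  nth-drop (suc n) (x ∷ xs) = nth-drop n xs

  drop≡∷⇒nth : ∀ n {xs : List A} {y ys} → drop n xs ≡ y ∷ ys → nth xs n ≡ just y
  drop≡∷⇒nth n {xs} eq = trans (sym (nth-drop n xs)) (cong (λ l → nth l 0) eq)

  drop-suc : ∀ n {xs : List A} {y ys} → drop n xs ≡ y ∷ ys → drop (suc n) xs ≡ ys
  drop-suc zero    refl = refl
  drop-suc (suc n) {x ∷ xs} eq = drop-suc n eq

sum-map-++ : ∀ {A : Set} (f : A → ℕ) xs ys →
  sum (map f (xs ++ ys)) ≡ sum (map f xs) + sum (map f ys)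
sum-map-++ f xs ys = trans (cong sum (map-++ f xs ys)) (sum-++ (map f xs) (map f ys))

-- f receives the column, the entry and the entry to its right.
rowSum : (ℕ → ℕ → Maybe ℕ → ℕ) → ℕ → List ℕ → ℕ
rowSum f c []       = 0
rowSum f c (x ∷ xs) = f c x (nth xs 0) + rowSum f (suc c) xs

rowSum-zero : ∀ f c xs → (∀ d x m → f d x m ≡ 0) → rowSum f c xs ≡ 0
rowSum-zero f c []       f≡0 = refl
rowSum-zero f c (x ∷ xs) f≡0 rewrite f≡0 c x (nth xs 0) = rowSum-zero f (suc c) xs f≡0

rowSum-zero-≥ : ∀ f i c {xs} → (∀ d x m → i ≤ x → f d x m ≡ 0) → All (i ≤_) xs →
  rowSum f c xs ≡ 0
rowSum-zero-≥ f i c f≡0 []           = refl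
rowSum-zero-≥ f i c {x ∷ xs} f≡0 (i≤x ∷ i≤xs)
  rewrite f≡0 c x (nth xs 0) i≤x = rowSum-zero-≥ f i (suc c) f≡0 i≤xs

countLastBelow : ℕ → (ℕ → Bool) → ℕ → ℕ → Maybe ℕ → ℕ
countLastBelow i W c x next = 𝟙 ((x <ᵇ i) ∧ W c ∧ maybe (i ≤ᵇ_) true next)

countBelow : ℕ → (ℕ → Bool) → ℕ → ℕ → Maybe ℕ → ℕ
countBelow i V c x _ = 𝟙 ((x <ᵇ i) ∧ V c)

countLastBelow-≥ : ∀ i W d x m → i ≤ x → countLastBelow i W d x m ≡ 0
countLastBelow-≥ i W d x m i≤x rewrite ≥⇒<ᵇ≡false i≤x = refl

countBelow-≥ : ∀ i V d x m → i ≤ x → countBelow i V d x m ≡ 0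
countBelow-≥ i V d x m i≤x rewrite ≥⇒<ᵇ≡false i≤x = refl

-- step makes W the running total of V, so the last entry below i sees at its
-- column the sum of V over the whole prefix of entries below i.
module _ (i : ℕ) {W V : ℕ → Bool}
         (step : ∀ d → 𝟙 (W (suc d)) ≡ 𝟙 (W d) + 𝟙 (V (suc d))) where

  countLastBelow-telescopes : ∀ {c x xs} → x < i → Linked _≤_ (x ∷ xs) →
    rowSum (countLastBelow i W) c (x ∷ xs) ≡ 𝟙 (W c) + rowSum (countBelow i V) (suc c) xs
  countLastBelow-telescopes {c} {x} {[]} x<i _
    rewrite <⇒<ᵇ≡true x<i | ∧-identityʳ (W c) = refl
  countLastBelow-telescopes {c} {x} {y ∷ ys} x<i (_ ∷ sorted) with y <? i
  ... | no y≮i rewrite <⇒<ᵇ≡true x<i | ≤⇒≤ᵇ≡true (≮⇒≥ y≮i) | ∧-identityʳ (W c) =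
    cong (𝟙 (W c) +_)
      (trans (rowSum-zero-≥ (countLastBelow i W) i (suc c) (countLastBelow-≥ i W) i≤rest)
             (sym (rowSum-zero-≥ (countBelow i V) i (suc c) (countBelow-≥ i V) i≤rest)))
    where i≤rest = Linked⇒All ≤-trans (≮⇒≥ y≮i) sorted
  ... | yes y<i = begin
    countLastBelow i W c x (just y) + rowSum (countLastBelow i W) (suc c) (y ∷ ys)
      ≡⟨ cong₂ _+_ notLast (countLastBelow-telescopes y<i sorted) ⟩
    𝟙 (W (suc c)) + rest
      ≡⟨ cong (_+ rest) (step c) ⟩
    𝟙 (W c) + 𝟙 (V (suc c)) + rest
      ≡⟨ +-assoc (𝟙 (W c)) _ rest ⟩
    𝟙 (W c) + (𝟙 (V (suc c)) + rest)
      ≡⟨ cong (λ b → 𝟙 (W c) + (𝟙 (b ∧ V (suc c)) + rest)) (sym (<⇒<ᵇ≡true y<i)) ⟩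
    𝟙 (W c) + rowSum (countBelow i V) (suc c) (y ∷ ys) ∎
    where
    open ≡-Reasoning
    rest = rowSum (countBelow i V) (suc (suc c)) ys
    notLast : countLastBelow i W c x (just y) ≡ 0
    notLast rewrite <⇒<ᵇ≡true x<i | >⇒≤ᵇ≡false y<i = cong 𝟙 (∧-zeroʳ (W c))

  countLastBelow≡countBelow : W 0 ≡ V 0 → ∀ {xs} → Linked _≤_ xs →
    rowSum (countLastBelow i W) 0 xs ≡ rowSum (countBelow i V) 0 xs
  countLastBelow≡countBelow base {[]}     _ = refl
  countLastBelow≡countBelow base {x ∷ xs} sorted with x <? i
  ... | yes x<i = begin
    rowSum (countLastBelow i W) 0 (x ∷ xs)
      ≡⟨ countLastBelow-telescopes x<i sorted ⟩
    𝟙 (W 0) + rest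
      ≡⟨ cong (λ b → 𝟙 b + rest) base ⟩
    𝟙 (V 0) + rest
      ≡⟨ cong (λ b → 𝟙 (b ∧ V 0) + rest) (sym (<⇒<ᵇ≡true x<i)) ⟩
    rowSum (countBelow i V) 0 (x ∷ xs) ∎
    where
    open ≡-Reasoning
    rest = rowSum (countBelow i V) 1 xs
  ... | no x≮i = trans (rowSum-zero-≥ (countLastBelow i W) i 0 (countLastBelow-≥ i W) i≤row)
                       (sym (rowSum-zero-≥ (countBelow i V) i 0 (countBelow-≥ i V) i≤row))
    where i≤row = Linked⇒All ≤-trans (≮⇒≥ x≮i) sorted

countLastBelow-vanishes : ∀ i {W} c {k xs} → (∀ {d} → d < c + k → W d ≡ false) →
  nth xs k ≡ just i → Linked _≤_ xs → rowSum (countLastBelow i W) c xs ≡ 0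
countLastBelow-vanishes i {W} c {zero} {x ∷ xs} _ refl sorted
  rewrite countLastBelow-≥ i W c x (nth xs 0) ≤-refl =
  rowSum-zero-≥ (countLastBelow i W) i (suc c) (countLastBelow-≥ i W)
                (All.tail (Linked⇒All ≤-trans ≤-refl sorted))
countLastBelow-vanishes i {W} c {suc k} {x ∷ xs} W≡false at sorted =
  trans (cong (_+ _) off) (countLastBelow-vanishes i (suc c) W≡false′ at (Linked.tail sorted))
  where
  W≡false′ : ∀ {d} → d < suc c + k → W d ≡ false
  W≡false′ {d} = W≡false ∘ subst (d <_) (sym (+-suc c k))
  off : countLastBelow i W c x (nth xs 0) ≡ 0
  off rewrite W≡false (m<m+n c {suc k} z<s) = cong 𝟙 (∧-zeroʳ (x <ᵇ i))

wWeight : ℕ → Bool → ℕ → Bool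
wWeight ca above c = ((ca ≡ᵇ c) ∧ above) ∨ (ca <ᵇ c)

valWeight : ℕ → Bool → Bool → ℕ → Bool
valWeight ca above below c = ((c ≡ᵇ ca) ∧ above) ∨ ((c ≡ᵇ suc ca) ∧ below)

wWeight-base : ∀ ca above below → wWeight ca above 0 ≡ valWeight ca above below 0
wWeight-base zero    _ _ = refl
wWeight-base (suc _) _ _ = refl

-- wWeight switches on at column ca (row above) or ca + 1 (row below), exactly
-- the column that valWeight marks.
wWeight-step : ∀ {above below} → below ≡ not above → ∀ ca d →
  𝟙 (wWeight ca above (suc d)) ≡ 𝟙 (wWeight ca above d) + 𝟙 (valWeight ca above below (suc d))
wWeight-step {true}  refl zero           zero    = refl
wWeight-step {false} refl zero           zero    = refl
wWeight-step         refl zero           (suc d) = refl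
wWeight-step         refl (suc zero)     zero    = refl
wWeight-step         refl (suc (suc ca)) zero    = refl
wWeight-step         refl (suc ca)       (suc d) = wWeight-step refl ca d

-- 𝟙 (wPair θ a b) and 𝟙 (valPair a b) unfold to wCount a b and valCount a b,
-- applied to the entry to the right of b.
wCount : Cell → Cell → Maybe ℕ → ℕ
wCount (ra , ca , i) (r , c , x) = countLastBelow i (wWeight ca (r <ᵇ ra)) c x

valCount : Cell → Cell → Maybe ℕ → ℕ
valCount (ra , ca , i) (r , c , x) = countBelow i (valWeight ca (r <ᵇ ra) (ra <ᵇ r)) c x

wCount≡valCount-row : ∀ ra ca i r {ρ} → Linked _≤_ ρ → (r ≡ ra → nth ρ ca ≡ just i) →
  rowSum (λ c x → wCount (ra , ca , i) (r , c , x)) 0 ρ ≡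
  rowSum (λ c x → valCount (ra , ca , i) (r , c , x)) 0 ρ
wCount≡valCount-row ra ca i r {ρ} sorted a∈ρ with r ≟ ra
... | no r≢ra =
  countLastBelow≡countBelow i (wWeight-step (≢⇒<ᵇ-flip r≢ra) ca)
                              (wWeight-base ca (r <ᵇ ra) (ra <ᵇ r)) sorted
... | yes refl =
  trans (countLastBelow-vanishes i 0 wOff (a∈ρ refl) sorted) (sym (rowSum-zero _ 0 ρ valOff))
  where
  wOff : ∀ {d} → d < ca → wWeight ca (ra <ᵇ ra) d ≡ false
  wOff {d} d<ca rewrite n<ᵇn≡false ra | ∧-zeroʳ (ca ≡ᵇ d) = ≥⇒<ᵇ≡false (<⇒≤ d<ca)
  valOff : ∀ d x m → valCount (ra , ca , i) (ra , d , x) m ≡ 0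
  valOff d x _ rewrite n<ᵇn≡false ra | ∧-zeroʳ (d ≡ᵇ ca) | ∧-zeroʳ (d ≡ᵇ suc ca) =
    cong 𝟙 (∧-zeroʳ (x <ᵇ i))

rowCells : ℕ → ℕ → List ℕ → List Cell
rowCells r c []       = []
rowCells r c (x ∷ xs) = (r , c , x) ∷ rowCells r (suc c) xs

zipWith-applyUpTo≡rowCells : ∀ r c (f : ℕ → ℕ) xs → (∀ t → f t ≡ c + t) →
  zipWith (λ c v → (r , c , v)) (applyUpTo f (length xs)) xs ≡ rowCells r c xs
zipWith-applyUpTo≡rowCells r c f []       _     = refl
zipWith-applyUpTo≡rowCells r c f (x ∷ xs) f≡c+ =
  cong₂ _∷_ (cong (λ c′ → (r , c′ , x)) (trans (f≡c+ 0) (+-identityʳ c)))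
            (zipWith-applyUpTo≡rowCells r (suc c) (f ∘ suc) xs
                                        (λ t → trans (f≡c+ (suc t)) (+-suc c t)))

cellsFrom-∷ : ∀ r ρ ρs → cellsFrom r (ρ ∷ ρs) ≡ rowCells r 0 ρ ++ cellsFrom (suc r) ρs
cellsFrom-∷ r ρ ρs =
  cong (_++ cellsFrom (suc r) ρs) (zipWith-applyUpTo≡rowCells r 0 (λ t → t) ρ (λ _ → refl))

gridSum : (Cell → Maybe ℕ → ℕ) → ℕ → Filling → ℕ
gridSum f r []       = 0
gridSum f r (ρ ∷ ρs) = rowSum (λ c x → f (r , c , x)) 0 ρ + gridSum f (suc r) ρs

module _ (θ : Filling) where

  rightOf : Cell → Maybe ℕ
  rightOf (r , c , _) = entry θ r (suc c)

  IsCellOf : Cell → Set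
  IsCellOf (r , c , x) = entry θ r c ≡ just x

  entry-row : ∀ {r ρ} c → nth θ r ≡ just ρ → entry θ r c ≡ nth ρ c
  entry-row {r} c eq with nth θ r
  entry-row c refl | just ρ = refl

  sum-rowCells : ∀ (f : Cell → Maybe ℕ → ℕ) {r ρ} c {xs} → nth θ r ≡ just ρ → drop c ρ ≡ xs →
    sum (map (λ b → f b (rightOf b)) (rowCells r c xs)) ≡ rowSum (λ c x → f (r , c , x)) c xs
  sum-rowCells f c {[]}     _   _  = refl
  sum-rowCells f {r} {ρ} c {x ∷ xs} row eq =
    cong₂ _+_ (cong (f (r , c , x)) right) (sum-rowCells f (suc c) row (drop-suc c eq))
    where
    right : entry θ r (suc c) ≡ nth xs 0
    right = trans (entry-row (suc c) row)
                  (trans (sym (nth-drop (suc c) ρ)) (cong (λ l → nth l 0) (drop-suc c eq)))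

  sum-cellsFrom : ∀ (f : Cell → Maybe ℕ → ℕ) {r ρs} → drop r θ ≡ ρs →
    sum (map (λ b → f b (rightOf b)) (cellsFrom r ρs)) ≡ gridSum f r ρs
  sum-cellsFrom f {r} {[]}     _  = refl
  sum-cellsFrom f {r} {ρ ∷ ρs} eq rewrite cellsFrom-∷ r ρ ρs =
    trans (sum-map-++ (λ b → f b (rightOf b)) (rowCells r 0 ρ) (cellsFrom (suc r) ρs))
          (cong₂ _+_ (sum-rowCells f 0 (drop≡∷⇒nth r eq) refl) (sum-cellsFrom f (drop-suc r eq)))

  rowCells-IsCellOf : ∀ {r ρ} c {xs} → nth θ r ≡ just ρ → drop c ρ ≡ xs →
    All IsCellOf (rowCells r c xs)
  rowCells-IsCellOf c {[]}     _   _  = []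
  rowCells-IsCellOf c {x ∷ xs} row eq =
    trans (entry-row c row) (drop≡∷⇒nth c eq) ∷ rowCells-IsCellOf (suc c) row (drop-suc c eq)

  cellsFrom-IsCellOf : ∀ {r ρs} → drop r θ ≡ ρs → All IsCellOf (cellsFrom r ρs)
  cellsFrom-IsCellOf {r} {[]}     _  = []
  cellsFrom-IsCellOf {r} {ρ ∷ ρs} eq rewrite cellsFrom-∷ r ρ ρs =
    ++⁺ (rowCells-IsCellOf 0 (drop≡∷⇒nth r eq) refl) (cellsFrom-IsCellOf (drop-suc r eq))

  wCount≡valCount-grid : ∀ {ra ca i} → IsCellOf (ra , ca , i) →
    ∀ {r ρs} → drop r θ ≡ ρs → All (Linked _≤_) ρs →
    gridSum (wCount (ra , ca , i)) r ρs ≡ gridSum (valCount (ra , ca , i)) r ρs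
  wCount≡valCount-grid a∈θ {r} {[]}     _  []                 = refl
  wCount≡valCount-grid {ra} {ca} {i} a∈θ {r} {ρ ∷ ρs} eq (sorted ∷ sorteds) =
    cong₂ _+_ (wCount≡valCount-row ra ca i r sorted a∈ρ)
              (wCount≡valCount-grid a∈θ (drop-suc r eq) sorteds)
    where
    a∈ρ : r ≡ ra → nth ρ ca ≡ just i
    a∈ρ refl = trans (sym (entry-row ca (drop≡∷⇒nth r eq))) a∈θ

  w≡val : All (Linked _≤_) θ → w θ ≡ val θ
  w≡val sorted = cong sum (map-cong-local (All.map partners (cellsFrom-IsCellOf {0} refl)))
    where
    open ≡-Reasoning
    partners : ∀ {a} → IsCellOf a →
      sum (map (λ b → 𝟙 (wPair θ a b)) (cells θ)) ≡ sum (map (λ b → 𝟙 (valPair a b)) (cells θ))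
    partners {a} a∈θ = begin
      sum (map (λ b → wCount a b (rightOf b)) (cells θ))   ≡⟨ sum-cellsFrom (wCount a) {0} refl ⟩
      gridSum (wCount a) 0 θ                              ≡⟨ wCount≡valCount-grid a∈θ {0} refl sorted ⟩
      gridSum (valCount a) 0 θ                            ≡⟨ sum-cellsFrom (valCount a) {0} refl ⟨
      sum (map (λ b → valCount a b (rightOf b)) (cells θ)) ∎

theorem4p6 : (sh μ : List ℕ) (θ : Filling) → IsPartition sh → IsPartition μ →
    IsTabloid sh μ θ → w θ ≡ val θ
theorem4p6 _ _ θ _ _ tabloid = w≡val θ (IsTabloid.rowsWeakly tabloid)
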